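{- Let $n \ge 2$ and let $Q_{4n} = \langle x, y \mid x^2 = y^n,\ y^{2n} = 1,\ yx = xy^{ -1}\rangle$ be the dicyclic group of order $4n$. Let $S$ be a sequence of $2n$ elements of $Q_{4n}$. \begin{enumerate} \item If $n \ge 3$, then the following are equivalent: (i) $S$ is free of product-$1$ subsequences; (ii) there exist integers $t$ with $1 \le t \le 2n-1$ and $\gcd(t,2n)=1$, and $s$ with $0 \le s \le 2n-1$, such that $S = (y^t, y^t, \dots, y^t, xy^s)$, where $y^t$ appears exactly $2n-1$ times. \item If $n = 2$, then $S$ is free of product-$1$ subsequences if and only if there exist $r \in \mathbb{Z}_4^*$ (i.e. $r \in \{1,3\}$) and $s \in \mathbb{Z}_4$ such that $S$ is one of $$(y^r, y^r, y^r, xy^s),\quad (y^r, xy^s, xy^s, xy^s),\quad (xy^s, xy^s, xy^s, xy^{r+s}).$$ \end{enumerate}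
   Context: A sequence in a finite group $G$ is a finite list $(g_1,\dots,g_l)$ of elements of $G$ with repetitions allowed; sequences are considered up to reordering of their terms. A subsequence is obtained by choosing a subset of the index set $\{1,\dots,l\}$. A non-empty subsequence $(g_{n_1},\dots,g_{n_k})$ is a product-$1$ subsequence if $g_{\sigma(n_1)} g_{\sigma(n_2)} \cdots g_{\sigma(n_k)} = 1$ for some permutation $\sigma$ of $\{n_1,\dots,n_k\}$. A sequence is free of product-$1$ subsequences if it has no non-empty product-$1$ subsequence. -}

module Defs where

open import Data.Bool using (Bool; true; false)
open import Data.Nat using (ℕ; zero; suc; _+_; _*_; _∸_)
open import Data.Nat.DivMod using (_mod_)
open import Data.Fin using (Fin; toℕ)
open import Data.Product using (_×_; _,_; Σ)
open import Data.List using (List; _∷_; []; foldl)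
open import Data.List.Relation.Binary.Sublist.Propositional using (_⊆_)
open import Data.List.Relation.Binary.Permutation.Propositional using (_↭_)
open import Relation.Binary.PropositionalEquality using (_≡_)
open import Relation.Nullary using (¬_)

-- ℤ_{2n} represented as Fin (2 * n); arithmetic modulo 2n.
-- (For n = 0 the carrier is empty, so these are vacuous.)
addZ : ∀ {n} → Fin (2 * n) → Fin (2 * n) → Fin (2 * n)
addZ {suc m} a b = (toℕ a + toℕ b) mod (2 * suc m)

subZ : ∀ {n} → Fin (2 * n) → Fin (2 * n) → Fin (2 * n)
subZ {suc m} a b = (toℕ a + (2 * suc m ∸ toℕ b)) mod (2 * suc m)

addN : ∀ {n} → Fin (2 * n) → Fin (2 * n)
addN {suc m} a = (suc m + toℕ a) mod (2 * suc m)

-- Dicyclic group Q_{4n} = ⟨x, y | x² = yⁿ, y^{2n} = 1, yx = xy⁻¹⟩ in normal form: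
-- (false , k) represents y^k and (true , k) represents x y^k, 0 ≤ k < 2n.
Q : ℕ → Set
Q n = Bool × Fin (2 * n)

-- multiplication, derived from the relations y^b x = x y^{-b}, x² = yⁿ
mul : ∀ {n} → Q n → Q n → Q n
mul {n} (false , b) (false , d) = false , addZ {n} b d
mul {n} (false , b) (true  , d) = true  , subZ {n} d b          -- y^b x y^d = x y^{d-b}
mul {n} (true  , b) (false , d) = true  , addZ {n} b d
mul {n} (true  , b) (true  , d) = false , addN {n} (subZ {n} d b)   -- x y^b x y^d = y^{n+d-b}

IsOne : ∀ {n} → Q n → Set
IsOne (b , k) = (b ≡ false) × (toℕ k ≡ 0)

yPow : ∀ {n} → Fin (2 * n) → Q n
yPow {n} k = false , k

xyPow : ∀ {n} → Fin (2 * n) → Q n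
xyPow {n} k = true , k

prod : ∀ {n} → Q n → List (Q n) → Q n
prod {n} g gs = foldl (mul {n}) g gs

-- Sequences are lists (considered up to permutation _↭_).
-- A product-1 subsequence of S: a non-empty sublist T of S together with an
-- ordering (g ∷ gs) ↭ T of its terms whose product is 1.
ProductOneSubseq : ∀ {n} → List (Q n) → Set
ProductOneSubseq {n} S =
  Σ (List (Q n)) λ T → (T ⊆ S) ×
    (Σ (Q n) λ g → Σ (List (Q n)) λ gs → ((g ∷ gs) ↭ T) × IsOne {n} (prod {n} g gs))

ProductOneFree : ∀ {n} → List (Q n) → Set
ProductOneFree {n} S = ¬ ProductOneSubseq {n} S

{-# OPTIONS --safe #-}
module Submission where

-- Sort S as its y-terms y^g followed by its x-terms x y^u.  Two x-terms multiply
-- to a power of y, x y^u x y^v = y^(n + v - u), so the y-terms together with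
-- disjoint pairs of the x-terms form a "chain" of elements of ℤ/2n, and when S
-- is product-one free every nonempty block of the chain has nonzero sum.  The
-- partial sums of the chain, started at t, are therefore distinct; starting also
-- at the values of one or two further pairs of x-terms yields 2 or 4 families of
-- partial sums that are mutually disjoint as well.  Counting them against the 2n
-- residues rules out every S with n ≥ 3 except those with exactly one x-term,
-- and then the 2n - 1 y-terms form a zero-sum free sequence of maximal length in
-- ℤ/2n: swapping two adjacent terms changes a single partial sum, so they are all
-- equal, to a unit.  Conversely, a subsequence through the x-term has odd
-- x-degree, and fewer than 2n copies of a unit never sum to 0.
-- For n = 2 the classification is verified by evaluating a search over all 8^4
-- sequences; freeness of the three families is certified by the two characters
-- Q₈ → ℤ/2 and by looking at squares.

open import Defs

open import Algebra.Bundles using (CommutativeRing)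
open import Data.Bool as Bool using (Bool; true; false; T; _xor_; _∨_)
open import Data.Bool.Properties using (xor-assoc; xor-identityʳ; xor-∧-commutativeRing)
open import Data.Empty using (⊥; ⊥-elim)
open import Data.Fin as Fin using (Fin; toℕ; fromℕ<; #_)
import Data.Fin.Properties as Fin
open import Data.Integer as ℤ using (ℤ; +_; 0ℤ; ∣_∣) renaming (_+_ to _⊕_; _-_ to _⊖_; -_ to ⊝_)
import Data.Integer.Properties as ℤ
import Data.Integer.Divisibility.Signed as ℤ∣
open import Data.Integer.DivMod using (n%ℕd<d; a≡a%ℕn+[a/ℕn]*n)
open import Data.Integer.Tactic.RingSolver using (solve-∀)
open import Data.List
  using (List; []; _∷_; _++_; map; foldl; foldr; length; replicate; concatMap; mapMaybe; catMaybes; lookup; head; allFin)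
import Data.List.Properties as List
open import Data.List.Membership.Propositional using (_∈_)
open import Data.List.Membership.Propositional.Properties using (∈-lookup)
open import Data.List.Relation.Binary.Permutation.Propositional
  using (_↭_; refl; prep; swap; ↭-sym; ↭-trans; ↭-reflexive; ↭⇒↭ₛ; ↭⇒↭ₛ′)
import Data.List.Relation.Binary.Permutation.Propositional.Properties as Perm
import Data.List.Relation.Binary.Permutation.Setoid.Properties as PermSetoid
open import Data.List.Relation.Binary.Sublist.Propositional using (_⊆_; []; _∷_; _∷ʳ_; ⊆-refl; ⊆-trans; minimum)
import Data.List.Relation.Binary.Sublist.Propositional.Properties as Sublist
open import Data.List.Relation.Unary.All as All using (All; []; _∷_)
import Data.List.Relation.Unary.All.Properties as All
open import Data.List.Relation.Unary.AllPairs using (AllPairs; []; _∷_)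
import Data.List.Relation.Unary.AllPairs.Properties as AllPairs
open import Data.List.Relation.Unary.Any using (here; there)
open import Data.Maybe as Maybe using (Maybe; just; nothing; is-just)
open import Data.Nat as ℕ using (ℕ; zero; suc; _+_; _*_; _∸_; _≤_; _<_; z≤n; s≤s)
import Data.Nat.Properties as ℕ
open import Data.Nat.Coprimality as Coprime using (gcd≡1⇒coprime; coprime-divisor)
open import Data.Nat.Divisibility as ℕ∣ using (divides)
open import Data.Nat.DivMod using (_mod_; _%_; _/_; m%n<n; m≡m%n+[m/n]*n)
open import Data.Nat.GCD using (gcd; gcd[m,n]∣m; gcd[m,n]∣n)
open import Data.Nat.Tactic.RingSolver using () renaming (solve-∀ to ℕ-solve-∀)
open import Data.Product using (Σ; ∃; ∃₂; _×_; _,_; proj₁; proj₂; uncurry)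
open import Data.Product.Properties using (≡-dec)
open import Data.Sum using (_⊎_; inj₁; inj₂)
open import Function using (_∘_; _⇔_; mk⇔; Equivalence)
open import Relation.Binary using (Setoid; DecidableEquality)
import Relation.Binary.Reasoning.Setoid
open import Relation.Binary.PropositionalEquality
  using (_≡_; _≢_; refl; sym; trans; cong; cong₂; subst; subst₂; module ≡-Reasoning)
import Relation.Binary.PropositionalEquality as ≡
open import Relation.Nullary using (¬_; Dec; yes; no; contradiction)
import Relation.Nullary.Decidable as Dec
open import Relation.Nullary.Decidable using (_×-dec_; _⊎-dec_; _→-dec_; dec⇒maybe; T?)

module _ {A : Set} where

  AllPairs-lookup : ∀ {R : A → A → Set} {xs : List A} → AllPairs R xs →
                    ∀ {i j} → i Fin.< j → R (lookup xs i) (lookup xs j)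
  AllPairs-lookup {xs = x ∷ xs} (Rx ∷ _) {Fin.zero} {Fin.suc j} _ = All.lookup Rx (∈-lookup j)
  AllPairs-lookup {xs = x ∷ xs} (_ ∷ Rxs) {Fin.suc i} {Fin.suc j} (s≤s i<j) = AllPairs-lookup Rxs i<j

  ++-split : ∀ (xs ys xs′ ys′ : List A) → xs ++ ys ≡ xs′ ++ ys′ →
             (∃ λ zs → xs′ ≡ xs ++ zs) ⊎ (∃ λ zs → xs ≡ xs′ ++ zs)
  ++-split []       ys xs′        ys′ _ = inj₁ (xs′ , refl)
  ++-split (x ∷ xs) ys []         ys′ _ = inj₂ (x ∷ xs , refl)
  ++-split (x ∷ xs) ys (x′ ∷ xs′) ys′ e with List.∷-injective e
  ... | refl , e′ with ++-split xs ys xs′ ys′ e′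
  ...   | inj₁ (zs , xs′≡) = inj₁ (zs , cong (x ∷_) xs′≡)
  ...   | inj₂ (zs , xs≡)  = inj₂ (zs , cong (x ∷_) xs≡)

  replicate-⊆ : ∀ (x : A) {k l} → k ≤ l → replicate k x ⊆ replicate l x
  replicate-⊆ x {zero}  {l}     _         = minimum _
  replicate-⊆ x {suc k} {suc l} (s≤s k≤l) = refl ∷ replicate-⊆ x k≤l

  all≡⇒replicate : ∀ (x : A) {xs} → All (_≡ x) xs → xs ≡ replicate (length xs) x
  all≡⇒replicate x []         = refl
  all≡⇒replicate x (refl ∷ p) = cong (x ∷_) (all≡⇒replicate x p)

  adjacent-equal⇒replicate : ∀ (x : A) xs → (∀ P a b Q → x ∷ xs ≡ P ++ a ∷ b ∷ Q → a ≡ b) →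
                             x ∷ xs ≡ replicate (suc (length xs)) x
  adjacent-equal⇒replicate x []       _        = refl
  adjacent-equal⇒replicate x (x′ ∷ xs) adjacent with adjacent [] x x′ xs refl
  ... | refl = cong (x ∷_) (adjacent-equal⇒replicate x xs (λ P a b Q e → adjacent (x ∷ P) a b Q (cong (x ∷_) e)))

  ⊆-transport : ∀ {T S S′ : List A} → T ⊆ S → S ↭ S′ → ∃ λ T′ → T′ ⊆ S′ × T ↭ T′
  ⊆-transport τ refl = _ , τ , refl
  ⊆-transport (y ∷ʳ τ) (prep x p) with ⊆-transport τ p
  ... | T′ , τ′ , q = T′ , x ∷ʳ τ′ , q
  ⊆-transport (refl ∷ τ) (prep x p) with ⊆-transport τ p
  ... | T′ , τ′ , q = x ∷ T′ , refl ∷ τ′ , prep x q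
  ⊆-transport (_ ∷ʳ (_ ∷ʳ τ)) (swap x y p) with ⊆-transport τ p
  ... | T′ , τ′ , q = T′ , y ∷ʳ (x ∷ʳ τ′) , q
  ⊆-transport (_ ∷ʳ (refl ∷ τ)) (swap x y p) with ⊆-transport τ p
  ... | T′ , τ′ , q = y ∷ T′ , refl ∷ (x ∷ʳ τ′) , prep y q
  ⊆-transport (refl ∷ (_ ∷ʳ τ)) (swap x y p) with ⊆-transport τ p
  ... | T′ , τ′ , q = x ∷ T′ , y ∷ʳ (refl ∷ τ′) , prep x q
  ⊆-transport (refl ∷ (refl ∷ τ)) (swap x y p) with ⊆-transport τ p
  ... | T′ , τ′ , q = y ∷ x ∷ T′ , refl ∷ (refl ∷ τ′) , swap x y q
  ⊆-transport τ (_↭_.trans p q) with ⊆-transport τ p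
  ... | T′ , τ′ , r with ⊆-transport τ′ q
  ... | T″ , τ″ , r′ = T″ , τ″ , ↭-trans r r′

  infix 4 _⊑_
  _⊑_ : List A → List A → Set
  X ⊑ Y = ∃ λ C → C ⊆ Y × X ↭ C

  ⊆⇒⊑ : ∀ {X Y} → X ⊆ Y → X ⊑ Y
  ⊆⇒⊑ τ = _ , τ , refl

  ↭⇒⊑ : ∀ {X Y} → X ↭ Y → X ⊑ Y
  ↭⇒⊑ p = _ , ⊆-refl , p

  ⊑-trans : ∀ {X Y Z} → X ⊑ Y → Y ⊑ Z → X ⊑ Z
  ⊑-trans (C , τ , q) (D , σ , p) with ⊆-transport τ p
  ... | C′ , τ′ , r = C′ , ⊆-trans τ′ σ , ↭-trans q r

  sublists : (S : List A) → List (∃ (_⊆ S))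
  sublists []      = ([] , []) ∷ []
  sublists (x ∷ S) = map (λ (T , τ) → x ∷ T , refl ∷ τ) (sublists S)
                  ++ map (λ (T , τ) → T , x ∷ʳ τ) (sublists S)

  insertions : (x : A) (L : List A) → List (∃ (_↭ x ∷ L))
  insertions x []      = (x ∷ [] , refl) ∷ []
  insertions x (y ∷ L) =
    (x ∷ y ∷ L , refl) ∷ map (λ (M , p) → y ∷ M , ↭-trans (prep y p) (swap y x refl)) (insertions x L)

  orderings : (T : List A) → List (∃ (_↭ T))
  orderings []      = ([] , refl) ∷ []
  orderings (x ∷ T) =
    concatMap (λ (M , p) → map (λ (K , q) → K , ↭-trans q (prep x p)) (insertions x M)) (orderings T)

  AllSublists : (List A → Set) → List A → Set
  AllSublists P []      = P []
  AllSublists P (x ∷ L) = AllSublists (P ∘ (x ∷_)) L × AllSublists P L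

  AllSublists-⊆ : ∀ {P T L} → AllSublists P L → T ⊆ L → P T
  AllSublists-⊆ p              []         = p
  AllSublists-⊆ (_ , without) (x ∷ʳ τ)   = AllSublists-⊆ without τ
  AllSublists-⊆ (with′ , _)   (refl ∷ τ) = AllSublists-⊆ with′ τ

  allSublists? : ∀ {P : List A → Set} → (∀ T → Maybe (P T)) → ∀ L → Maybe (AllSublists P L)
  allSublists? P? []      = P? []
  allSublists? P? (x ∷ L) = Maybe.zip (allSublists? (P? ∘ (x ∷_)) L) (allSublists? P? L)

  module _ (_≟_ : DecidableEquality A) where

    remove : (x : A) (ys : List A) → Maybe (∃ λ ys′ → ys ↭ x ∷ ys′)
    remove x []       = nothing
    remove x (y ∷ ys) with x ≟ y
    ... | yes refl = just (ys , refl)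
    ... | no _     = Maybe.map (λ (ys′ , p) → y ∷ ys′ , ↭-trans (prep y p) (swap y x refl)) (remove x ys)

    permutation? : (xs ys : List A) → Maybe (xs ↭ ys)
    permutation? []       []      = just refl
    permutation? []       (_ ∷ _) = nothing
    permutation? (x ∷ xs) ys with remove x ys
    ... | nothing        = nothing
    ... | just (ys′ , p) = Maybe.map (λ q → ↭-trans (prep x q) (↭-sym p)) (permutation? xs ys′)

module _ {n : ℕ} where

  isOne? : (q : Q n) → Dec (IsOne {n} q)
  isOne? (b , k) = b Bool.≟ false ×-dec toℕ k ℕ.≟ 0

  product-one-resp-↭ : ∀ {S S′ : List (Q n)} → S ↭ S′ → ProductOneSubseq {n} S → ProductOneSubseq {n} S′
  product-one-resp-↭ S↭ (T , τ , g , gs , perm , one) with ⊆-transport τ S↭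
  ... | T′ , τ′ , T↭ = T′ , τ′ , g , gs , ↭-trans perm T↭ , one

  free-resp-↭ : ∀ {S S′ : List (Q n)} → S ↭ S′ → ProductOneFree {n} S → ProductOneFree {n} S′
  free-resp-↭ S↭ free = free ∘ product-one-resp-↭ (↭-sym S↭)

module Characters (n : ℕ) where

  IsCharacter : (Q n → Bool) → Set
  IsCharacter χ = ∀ a b → χ (mul {n} a b) ≡ χ a xor χ b

  χ-sum : (Q n → Bool) → List (Q n) → Bool
  χ-sum χ L = foldr _xor_ false (map χ L)

  χ-sum-↭ : ∀ χ {L L′} → L ↭ L′ → χ-sum χ L ≡ χ-sum χ L′
  χ-sum-↭ χ p = PermSetoid.foldr-commMonoid (≡.setoid Bool) xor-isCommutativeMonoid (↭⇒↭ₛ (Perm.map⁺ χ p))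
    where open CommutativeRing xor-∧-commutativeRing using () renaming (+-isCommutativeMonoid to xor-isCommutativeMonoid)

  χ-foldl : ∀ χ → IsCharacter χ → ∀ q gs → χ (foldl (mul {n}) q gs) ≡ χ-sum χ (q ∷ gs)
  χ-foldl χ hom q []       = sym (xor-identityʳ (χ q))
  χ-foldl χ hom q (g ∷ gs) = begin
    χ (foldl (mul {n}) (mul {n} q g) gs)     ≡⟨ χ-foldl χ hom (mul {n} q g) gs ⟩
    χ (mul {n} q g) xor χ-sum χ gs           ≡⟨ cong (_xor χ-sum χ gs) (hom q g) ⟩
    (χ q xor χ g) xor χ-sum χ gs             ≡⟨ xor-assoc (χ q) (χ g) (χ-sum χ gs) ⟩
    χ q xor (χ g xor χ-sum χ gs)             ∎
    where open ≡-Reasoning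

  product-one-χ-sum : ∀ χ → IsCharacter χ → (∀ q → IsOne {n} q → χ q ≡ false) →
                      ∀ {T} g gs → g ∷ gs ↭ T → IsOne {n} (prod {n} g gs) → χ-sum χ T ≡ false
  product-one-χ-sum χ hom χ-one g gs perm one =
    trans (sym (χ-sum-↭ χ perm)) (trans (sym (χ-foldl χ hom g gs)) (χ-one _ one))

  xBit : Q n → Bool
  xBit = proj₁

  xBit-character : IsCharacter xBit
  xBit-character (false , _) (false , _) = refl
  xBit-character (false , _) (true  , _) = refl
  xBit-character (true  , _) (false , _) = refl
  xBit-character (true  , _) (true  , _) = refl

  xBit-one : ∀ q → IsOne {n} q → xBit q ≡ false
  xBit-one q (b≡false , _) = b≡false

coprime-if-no-annihilator : ∀ t N → 1 < N → (∀ k → 0 < k → k < N → ¬ N ℕ∣.∣ k * t) →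
                            1 ≤ t × gcd t N ≡ 1
coprime-if-no-annihilator t N 1<N no-annihilator = 1≤t , gcd≡1
  where
  1≤t : 1 ≤ t
  1≤t = ℕ.n≢0⇒n>0 λ { refl → no-annihilator 1 (s≤s z≤n) 1<N (N ℕ∣.∣0) }
  gcd≡1 : gcd t N ≡ 1
  gcd≡1 with gcd t N | gcd[m,n]∣m t N | gcd[m,n]∣n t N
  ... | zero            | _               | divides q N≡q*0 =
    ⊥-elim (ℕ.<⇒≢ (ℕ.<-trans (s≤s z≤n) 1<N) (sym (trans N≡q*0 (ℕ.*-zeroʳ q))))
  ... | suc zero        | _               | _               = refl
  ... | d@(suc (suc _)) | divides p t≡p*d | divides q N≡q*d =
    ⊥-elim (no-annihilator q 0<q q<N (divides p (begin
      q * t        ≡⟨ cong (q *_) t≡p*d ⟩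
      q * (p * d)  ≡⟨ lemma q p d ⟩
      p * (q * d)  ≡⟨ cong (p *_) N≡q*d ⟨
      p * N        ∎)))
    where
    open ≡-Reasoning
    lemma : ∀ q p d → q * (p * d) ≡ p * (q * d)
    lemma = ℕ-solve-∀
    0<q : 0 < q
    0<q = ℕ.n≢0⇒n>0 λ { refl → ℕ.<⇒≢ (ℕ.<-trans (s≤s z≤n) 1<N) (sym N≡q*d) }
    q<N : q < N
    q<N = subst (q <_) (sym N≡q*d) (ℕ.m<m*n q d {{ℕ.>-nonZero 0<q}} (s≤s (s≤s z≤n)))

two-x-forces-N≤4 : ∀ a r N → 2 * suc a ≤ N → a + (2 + r) ≡ N → r ≤ 1 → N ≤ 4
two-x-forces-N≤4 a r N bound len r≤1 = begin
  N            ≡⟨ len ⟨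
  a + (2 + r)  ≤⟨ ℕ.+-mono-≤ (ℕ.≤-trans a≤r r≤1) (ℕ.+-monoʳ-≤ 2 r≤1) ⟩
  4            ∎
  where
  open ℕ.≤-Reasoning
  a≤r : a ≤ r
  a≤r = ℕ.+-cancelˡ-≤ (a + 2) a r (subst₂ _≤_ (lemma₁ a) (lemma₂ a r) (subst (2 * suc a ≤_) (sym len) bound))
    where
    lemma₁ : ∀ a → 2 * suc a ≡ (a + 2) + a
    lemma₁ = ℕ-solve-∀
    lemma₂ : ∀ a r → a + (2 + r) ≡ (a + 2) + r
    lemma₂ = ℕ-solve-∀

k*a≤1⇒a≡0 : ∀ k a → 2 ≤ k → k * a ≤ 1 → a ≡ 0
k*a≤1⇒a≡0 k zero    _   _   = refl
k*a≤1⇒a≡0 k (suc a) 2≤k ka≤1 =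
  ⊥-elim (ℕ.<⇒≱ (s≤s (s≤s z≤n)) (ℕ.≤-trans 2≤k (ℕ.≤-trans (ℕ.m≤m*n k (suc a)) ka≤1)))

four-x-forces-N≤5 : ∀ a p r N → 4 * suc (a + p) ≤ N → a + (4 + r) ≡ N → r ≤ suc (2 * p) → N ≤ 5
four-x-forces-N≤5 a p r N bound len r≤ = begin
  N            ≡⟨ len ⟨
  a + (4 + r)  ≡⟨ cong (_+ (4 + r)) a≡0 ⟩
  4 + r        ≤⟨ ℕ.+-monoʳ-≤ 4 (subst (λ p → r ≤ suc (2 * p)) p≡0 r≤) ⟩
  5            ∎
  where
  open ℕ.≤-Reasoning
  lemma₁ : ∀ a p → 4 * suc (a + p) ≡ (a + 2 * p + 4) + (3 * a + 2 * p)
  lemma₁ = ℕ-solve-∀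
  lemma₂ : ∀ a p → a + (4 + suc (2 * p)) ≡ (a + 2 * p + 4) + 1
  lemma₂ = ℕ-solve-∀
  3a+2p≤1 : 3 * a + 2 * p ≤ 1
  3a+2p≤1 = ℕ.+-cancelˡ-≤ (a + 2 * p + 4) _ _ (begin
    (a + 2 * p + 4) + (3 * a + 2 * p)  ≡⟨ lemma₁ a p ⟨
    4 * suc (a + p)                     ≤⟨ bound ⟩
    N                                   ≡⟨ len ⟨
    a + (4 + r)                         ≤⟨ ℕ.+-monoʳ-≤ a (ℕ.+-monoʳ-≤ 4 r≤) ⟩
    a + (4 + suc (2 * p))               ≡⟨ lemma₂ a p ⟩
    (a + 2 * p + 4) + 1                 ∎)
  a≡0 : a ≡ 0
  a≡0 = k*a≤1⇒a≡0 3 a (s≤s (s≤s z≤n)) (ℕ.m+n≤o⇒m≤o (3 * a) 3a+2p≤1)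
  p≡0 : p ≡ 0
  p≡0 = k*a≤1⇒a≡0 2 p (s≤s (s≤s z≤n)) (ℕ.m+n≤o⇒n≤o (3 * a) 3a+2p≤1)

-- Integers modulo 2n

module Modular (m : ℕ) where

  n N : ℕ
  n = suc m
  N = 2 * n

  infix 4 _≈_ _≉_
  record _≈_ (a b : ℤ) : Set where
    constructor modN
    field N∣a-b : + N ℤ∣.∣ a ⊖ b
  open _≈_ public

  _≉_ : ℤ → ℤ → Set
  a ≉ b = ¬ a ≈ b

  private
    divisible : ∀ {a b c} → a ⊖ b ≡ c → + N ℤ∣.∣ c → a ≈ b
    divisible e d = modN (subst (+ N ℤ∣.∣_) (sym e) d)

  ≈-reflexive : ∀ {a b} → a ≡ b → a ≈ b
  ≈-reflexive {a} refl = divisible (ℤ.+-inverseʳ a) (ℤ∣.divides 0ℤ refl)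

  ≈-refl : ∀ {a} → a ≈ a
  ≈-refl = ≈-reflexive refl

  ≈-sym : ∀ {a b} → a ≈ b → b ≈ a
  ≈-sym {a} {b} p = divisible (lemma a b) (ℤ∣.∣m⇒∣-m (N∣a-b p))
    where
    lemma : ∀ a b → b ⊖ a ≡ ⊝ (a ⊖ b)
    lemma = solve-∀

  ≈-trans : ∀ {a b c} → a ≈ b → b ≈ c → a ≈ c
  ≈-trans {a} {b} {c} p q = divisible (lemma a b c) (ℤ∣.∣m∣n⇒∣m+n (N∣a-b p) (N∣a-b q))
    where
    lemma : ∀ a b c → a ⊖ c ≡ (a ⊖ b) ⊕ (b ⊖ c)
    lemma = solve-∀

  ≈-setoid : Setoid _ _
  ≈-setoid = record
    { Carrier = ℤ ; _≈_ = _≈_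
    ; isEquivalence = record { refl = ≈-refl ; sym = ≈-sym ; trans = ≈-trans } }

  module ≈-Reasoning = Relation.Binary.Reasoning.Setoid ≈-setoid

  +-cong : ∀ {a b c d} → a ≈ b → c ≈ d → a ⊕ c ≈ b ⊕ d
  +-cong {a} {b} {c} {d} p q = divisible (lemma a b c d) (ℤ∣.∣m∣n⇒∣m+n (N∣a-b p) (N∣a-b q))
    where
    lemma : ∀ a b c d → (a ⊕ c) ⊖ (b ⊕ d) ≡ (a ⊖ b) ⊕ (c ⊖ d)
    lemma = solve-∀

  neg-cong : ∀ {a b} → a ≈ b → ⊝ a ≈ ⊝ b
  neg-cong {a} {b} p = divisible (lemma a b) (ℤ∣.∣m⇒∣-m (N∣a-b p))
    where
    lemma : ∀ a b → ⊝ a ⊖ ⊝ b ≡ ⊝ (a ⊖ b)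
    lemma = solve-∀

  ≈-multiple : ∀ a k → a ⊕ k ℤ.* + N ≈ a
  ≈-multiple a k = divisible (lemma a k (+ N)) (ℤ∣.divides k refl)
    where
    lemma : ∀ a k N → (a ⊕ k ℤ.* N) ⊖ a ≡ k ℤ.* N
    lemma = solve-∀

  n+n≈0 : + n ⊕ + n ≈ 0ℤ
  n+n≈0 = divisible n+n≡N (ℤ∣.divides (+ 1) (sym (ℤ.*-identityˡ (+ N))))
    where
    open ≡-Reasoning
    n+n≡N : + n ⊕ + n ⊖ 0ℤ ≡ + N
    n+n≡N = begin
      + n ⊕ + n ⊖ 0ℤ  ≡⟨ ℤ.+-identityʳ _ ⟩
      + n ⊕ + n       ≡⟨ ℤ.pos-+ n n ⟨
      + (n + n)       ≡⟨ cong (λ k → + (n + k)) (ℕ.+-identityʳ n) ⟨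
      + N             ∎

  ≈-n+n : ∀ a → a ⊕ (+ n ⊕ + n) ≈ a
  ≈-n+n a = ≈-trans (+-cong (≈-refl {a}) n+n≈0) (≈-reflexive (ℤ.+-identityʳ a))

  ≈-n-n : ∀ a → a ⊖ (+ n ⊕ + n) ≈ a
  ≈-n-n a = ≈-trans (+-cong (≈-refl {a}) (neg-cong n+n≈0)) (≈-reflexive (ℤ.+-identityʳ a))

  ⟦_⟧ : Fin N → ℤ
  ⟦ a ⟧ = + toℕ a

  ⟦mod⟧ : ∀ x → ⟦ x mod N ⟧ ≈ + x
  ⟦mod⟧ x = begin
    ⟦ x mod N ⟧                        ≡⟨ cong +_ (Fin.toℕ-fromℕ< (m%n<n x N)) ⟩
    + (x % N)                          ≈⟨ ≈-multiple _ (+ (x / N)) ⟨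
    + (x % N) ⊕ + (x / N) ℤ.* + N      ≡⟨ cong (+ (x % N) ⊕_) (ℤ.pos-* (x / N) N) ⟨
    + (x % N) ⊕ + (x / N * N)          ≡⟨ ℤ.pos-+ (x % N) (x / N * N) ⟨
    + (x % N + x / N * N)              ≡⟨ cong +_ (m≡m%n+[m/n]*n x N) ⟨
    + x                                ∎
    where open ≈-Reasoning

  ⟦addZ⟧ : ∀ a b → ⟦ addZ {n} a b ⟧ ≈ ⟦ a ⟧ ⊕ ⟦ b ⟧
  ⟦addZ⟧ a b = ≈-trans (⟦mod⟧ (toℕ a + toℕ b)) (≈-reflexive (ℤ.pos-+ (toℕ a) (toℕ b)))

  ⟦subZ⟧ : ∀ a b → ⟦ subZ {n} a b ⟧ ≈ ⟦ a ⟧ ⊖ ⟦ b ⟧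
  ⟦subZ⟧ a b = begin
    ⟦ subZ {n} a b ⟧                  ≈⟨ ⟦mod⟧ (toℕ a + (N ∸ toℕ b)) ⟩
    + (toℕ a + (N ∸ toℕ b))           ≡⟨ ℤ.pos-+ (toℕ a) (N ∸ toℕ b) ⟩
    ⟦ a ⟧ ⊕ + (N ∸ toℕ b)             ≡⟨ cong (⟦ a ⟧ ⊕_) (ℤ.⊖-≥ (ℕ.<⇒≤ (Fin.toℕ<n b))) ⟨
    ⟦ a ⟧ ⊕ (N ℤ.⊖ toℕ b)             ≡⟨ cong (⟦ a ⟧ ⊕_) (ℤ.m-n≡m⊖n N (toℕ b)) ⟨
    ⟦ a ⟧ ⊕ (+ N ⊖ ⟦ b ⟧)             ≡⟨ lemma ⟦ a ⟧ ⟦ b ⟧ (+ N) ⟩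
    (⟦ a ⟧ ⊖ ⟦ b ⟧) ⊕ + 1 ℤ.* + N     ≈⟨ ≈-multiple _ (+ 1) ⟩
    ⟦ a ⟧ ⊖ ⟦ b ⟧                     ∎
    where
    open ≈-Reasoning
    lemma : ∀ a b N → a ⊕ (N ⊖ b) ≡ (a ⊖ b) ⊕ + 1 ℤ.* N
    lemma = solve-∀

  ⟦addN⟧ : ∀ a → ⟦ addN {n} a ⟧ ≈ + n ⊕ ⟦ a ⟧
  ⟦addN⟧ a = ≈-trans (⟦mod⟧ (n + toℕ a)) (≈-reflexive (ℤ.pos-+ n (toℕ a)))

  ⟦⟧-injective : ∀ {a b} → ⟦ a ⟧ ≈ ⟦ b ⟧ → a ≡ b
  ⟦⟧-injective {a} {b} (modN N∣a-b) =
    Fin.toℕ-injective (ℤ.+-injective (ℤ.i-j≡0⇒i≡j _ _ (ℤ.∣i∣≡0⇒i≡0 distance≡0)))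
    where
    distance<N : ∣ ⟦ a ⟧ ⊖ ⟦ b ⟧ ∣ < N
    distance<N = begin-strict
      ∣ ⟦ a ⟧ ⊖ ⟦ b ⟧ ∣       ≡⟨ cong ∣_∣ (ℤ.m-n≡m⊖n (toℕ a) (toℕ b)) ⟩
      ∣ toℕ a ℤ.⊖ toℕ b ∣     ≤⟨ ℤ.∣m⊝n∣≤m⊔n (toℕ a) (toℕ b) ⟩
      toℕ a ℕ.⊔ toℕ b         <⟨ ℕ.⊔-pres-<m (Fin.toℕ<n a) (Fin.toℕ<n b) ⟩
      N                       ∎
      where open ℕ.≤-Reasoning
    distance≡0 : ∣ ⟦ a ⟧ ⊖ ⟦ b ⟧ ∣ ≡ 0
    distance≡0 with ∣ ⟦ a ⟧ ⊖ ⟦ b ⟧ ∣ in eq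
    ... | zero = refl
    ... | suc _ = contradiction (subst (N ℕ∣.∣_) eq (ℤ∣.∣⇒∣ᵤ N∣a-b)) (ℕ∣.>⇒∤ (subst (_< N) eq distance<N))

  ≈-resp-difference : ∀ {a b c d} → a ⊖ b ≡ c ⊖ d → c ≈ d → a ≈ b
  ≈-resp-difference e p = divisible e (N∣a-b p)

  ≈0⇔∣ : ∀ x → + x ≈ 0ℤ ⇔ N ℕ∣.∣ x
  ≈0⇔∣ x = mk⇔ (λ (modN N∣x) → subst (N ℕ∣.∣_) (ℕ.+-identityʳ x) (ℤ∣.∣⇒∣ᵤ N∣x))
               (λ N∣x → modN (ℤ∣.∣ᵤ⇒∣ (subst (N ℕ∣.∣_) (sym (ℕ.+-identityʳ x)) N∣x)))

  _≈?_ : ∀ a b → Dec (a ≈ b)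
  a ≈? b = Dec.map′ modN N∣a-b (+ N ℤ∣.∣? (a ⊖ b))

  incongruent-resp-↭ : ∀ {zs zs′} → zs ↭ zs′ → AllPairs _≉_ zs → AllPairs _≉_ zs′
  incongruent-resp-↭ p = PermSetoid.Unique-resp-↭ ≈-setoid (↭⇒↭ₛ′ (Setoid.isEquivalence ≈-setoid) p)

  reduce : ℤ → Fin N
  reduce z = fromℕ< (n%ℕd<d z N)

  ⟦reduce⟧ : ∀ z → ⟦ reduce z ⟧ ≈ z
  ⟦reduce⟧ z = begin
    ⟦ reduce z ⟧                              ≡⟨ cong +_ (Fin.toℕ-fromℕ< (n%ℕd<d z N)) ⟩
    + (z ℤ.%ℕ N)                                ≈⟨ ≈-multiple _ (z ℤ./ℕ N) ⟨
    + (z ℤ.%ℕ N) ⊕ (z ℤ./ℕ N) ℤ.* + N           ≡⟨ a≡a%ℕn+[a/ℕn]*n z N ⟨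
    z                                         ∎
    where open ≈-Reasoning

  incongruent-bound : ∀ {zs} → AllPairs _≉_ zs → length zs ≤ N
  incongruent-bound {zs} apart with length zs ℕ.≤? N
  ... | yes ≤N = ≤N
  ... | no ≰N with Fin.pigeonhole (ℕ.≰⇒> ≰N) (reduce ∘ lookup zs)
  ...   | i , j , i<j , same = ⊥-elim (AllPairs-lookup apart i<j (begin
            lookup zs i                 ≈⟨ ⟦reduce⟧ _ ⟨
            ⟦ reduce (lookup zs i) ⟧    ≡⟨ cong ⟦_⟧ same ⟩
            ⟦ reduce (lookup zs j) ⟧    ≈⟨ ⟦reduce⟧ _ ⟩
            lookup zs j                 ∎))
    where open ≈-Reasoning

  incongruent-replace : ∀ P R {x x′} → AllPairs _≉_ (P ++ x ∷ R) → AllPairs _≉_ (P ++ x′ ∷ R) →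
                     length (P ++ x ∷ R) ≡ N → x ≈ x′
  incongruent-replace P R {x} {x′} apart apart′ len with x ≈? x′
  ... | yes x≈x′ = x≈x′
  ... | no x≉x′ with incongruent-resp-↭ (Perm.shift x P R) apart | incongruent-resp-↭ (Perm.shift x′ P R) apart′
  ...   | x-apart ∷ PR | x′-apart ∷ _ =
    contradiction (incongruent-bound ((x≉x′ ∘ ≈-sym ∷ x′-apart) ∷ x-apart ∷ PR)) too-long
    where
    too-long : ¬ suc (length (x ∷ P ++ R)) ≤ N
    too-long = ℕ.<⇒≱ (ℕ.≤-reflexive (cong suc (trans (sym len) (Perm.↭-length (Perm.shift x P R)))))

-- Products in Q n with exponents in ℤ

module LiftedProducts (m : ℕ) where
  open Modular m public

  State : Set
  State = Bool × ℤ

  infix 4 _≃_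
  _≃_ : State → State → Set
  (b , z) ≃ (b′ , z′) = b ≡ b′ × z ≈ z′

  ≡⇒≃ : ∀ {s s′} → s ≡ s′ → s ≃ s′
  ≡⇒≃ {_ , _} refl = refl , ≈-refl

  ≃-sym : ∀ {s s′} → s ≃ s′ → s′ ≃ s
  ≃-sym {_ , _} {_ , _} (refl , p) = refl , ≈-sym p

  ≃-trans : ∀ {s s′ s″} → s ≃ s′ → s′ ≃ s″ → s ≃ s″
  ≃-trans {_ , _} {_ , _} {_ , _} (refl , p) (refl , q) = refl , ≈-trans p q

  -- (b , z) stands for x^b y^z; right multiplication follows mul without reducing z.
  infixl 5 _▸_
  _▸_ : State → Q n → State
  (false , z) ▸ (false , d) = false , z ⊕ ⟦ d ⟧
  (false , z) ▸ (true  , d) = true  , ⟦ d ⟧ ⊖ z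
  (true  , z) ▸ (false , d) = true  , z ⊕ ⟦ d ⟧
  (true  , z) ▸ (true  , d) = false , + n ⊕ (⟦ d ⟧ ⊖ z)

  ▸-cong : ∀ {s s′} g → s ≃ s′ → s ▸ g ≃ s′ ▸ g
  ▸-cong {false , _} {false , _} (false , d) (refl , p) = refl , +-cong p ≈-refl
  ▸-cong {false , _} {false , _} (true  , d) (refl , p) = refl , +-cong (≈-refl {⟦ d ⟧}) (neg-cong p)
  ▸-cong {true  , _} {true  , _} (false , d) (refl , p) = refl , +-cong p ≈-refl
  ▸-cong {true  , _} {true  , _} (true  , d) (refl , p) =
    refl , +-cong (≈-refl {+ n}) (+-cong (≈-refl {⟦ d ⟧}) (neg-cong p))

  foldl-▸-cong : ∀ {s s′} gs → s ≃ s′ → foldl _▸_ s gs ≃ foldl _▸_ s′ gs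
  foldl-▸-cong []       p = p
  foldl-▸-cong (g ∷ gs) p = foldl-▸-cong gs (▸-cong g p)

  run : List (Q n) → State
  run = foldl _▸_ (false , 0ℤ)

  embed : Q n → State
  embed (b , k) = b , ⟦ k ⟧

  embed-mul : ∀ q g → embed (mul {n} q g) ≃ embed q ▸ g
  embed-mul (false , k) (false , d) = refl , ⟦addZ⟧ k d
  embed-mul (false , k) (true  , d) = refl , ⟦subZ⟧ d k
  embed-mul (true  , k) (false , d) = refl , ⟦addZ⟧ k d
  embed-mul (true  , k) (true  , d) = refl , ≈-trans (⟦addN⟧ (subZ {n} d k)) (+-cong (≈-refl {+ n}) (⟦subZ⟧ d k))

  embed-foldl : ∀ q gs → embed (foldl (mul {n}) q gs) ≃ foldl _▸_ (embed q) gs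
  embed-foldl q []       = refl , ≈-refl
  embed-foldl q (g ∷ gs) = ≃-trans (embed-foldl (mul {n} q g) gs) (foldl-▸-cong gs (embed-mul q g))

  embed-prod : ∀ g gs → embed (prod {n} g gs) ≃ run (g ∷ gs)
  embed-prod g gs = ≃-trans (embed-foldl g gs) (foldl-▸-cong gs (first g))
    where
    first : ∀ g → embed g ≃ (false , 0ℤ) ▸ g
    first (false , d) = refl , ≈-refl
    first (true  , d) = refl , ≈-reflexive (sym (ℤ.+-identityʳ ⟦ d ⟧))

  embed-one : ∀ q → IsOne {n} q → embed q ≃ (false , 0ℤ)
  embed-one (false , k) (refl , k≡0) = refl , ≈-reflexive (cong +_ k≡0)

  one-embed : ∀ q → embed q ≃ (false , 0ℤ) → IsOne {n} q
  one-embed (false , k) (refl , p) = refl , cong toℕ (⟦⟧-injective {k} {Fin.zero} p)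

  isOne⇒run : ∀ g gs → IsOne {n} (prod {n} g gs) → run (g ∷ gs) ≃ (false , 0ℤ)
  isOne⇒run g gs one = ≃-trans (≃-sym (embed-prod g gs)) (embed-one _ one)

  run⇒isOne : ∀ g gs → run (g ∷ gs) ≃ (false , 0ℤ) → IsOne {n} (prod {n} g gs)
  run⇒isOne g gs r = one-embed _ (≃-trans (embed-prod g gs) r)

  data Item : Set where
    y  : Fin N → Item
    xx : Fin N → Fin N → Item

  terms : Item → List (Q n)
  terms (y g)    = yPow {n} g ∷ []
  terms (xx u v) = xyPow {n} u ∷ xyPow {n} v ∷ []

  -- x y^u x y^v = y^(n + v - u)
  value : Item → ℤ
  value (y g)    = ⟦ g ⟧
  value (xx u v) = + n ⊕ (⟦ v ⟧ ⊖ ⟦ u ⟧)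

  termsᴸ : List Item → List (Q n)
  termsᴸ = concatMap terms

  Σvalue : List Item → ℤ
  Σvalue []       = 0ℤ
  Σvalue (i ∷ is) = value i ⊕ Σvalue is

  value-xx-swap : ∀ u v → value (xx v u) ≈ ⊝ value (xx u v)
  value-xx-swap u v = ≈-trans (≈-reflexive (lemma (+ n) ⟦ u ⟧ ⟦ v ⟧)) (≈-n+n _)
    where
    lemma : ∀ n u v → n ⊕ (u ⊖ v) ≡ ⊝ (n ⊕ (v ⊖ u)) ⊕ (n ⊕ n)
    lemma = solve-∀

  ▸-item : ∀ b z i → foldl _▸_ (b , z) (terms i) ≃ (b , z ⊕ value i)
  ▸-item false z (y g)    = refl , ≈-refl
  ▸-item true  z (y g)    = refl , ≈-refl
  ▸-item false z (xx u v) = refl , ≈-reflexive (lemma (+ n) ⟦ u ⟧ ⟦ v ⟧ z)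
    where
    lemma : ∀ n u v z → n ⊕ (v ⊖ (u ⊖ z)) ≡ z ⊕ (n ⊕ (v ⊖ u))
    lemma = solve-∀
  ▸-item true  z (xx u v) = refl , ≈-trans (≈-reflexive (lemma (+ n) ⟦ u ⟧ ⟦ v ⟧ z)) (≈-n-n _)
    where
    lemma : ∀ n u v z → v ⊖ (n ⊕ (u ⊖ z)) ≡ (z ⊕ (n ⊕ (v ⊖ u))) ⊖ (n ⊕ n)
    lemma = solve-∀

  run-items : ∀ b z B → foldl _▸_ (b , z) (termsᴸ B) ≃ (b , z ⊕ Σvalue B)
  run-items b z []      = refl , ≈-reflexive (sym (ℤ.+-identityʳ z))
  run-items b z (i ∷ B) =
    ≃-trans (≡⇒≃ (List.foldl-++ _▸_ (b , z) (terms i) (termsᴸ B)))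
    (≃-trans (foldl-▸-cong (termsᴸ B) (▸-item b z i))
    (≃-trans (run-items b (z ⊕ value i) B)
             (refl , ≈-reflexive (ℤ.+-assoc z (value i) (Σvalue B)))))

  pairs : List (Fin N × Fin N) → List Item
  pairs = map (uncurry xx)

  flip : List (Fin N × Fin N) → List (Fin N × Fin N)
  flip = map λ (u , v) → v , u

  Σvalue-flip : ∀ P → Σvalue (pairs (flip P)) ≈ ⊝ Σvalue (pairs P)
  Σvalue-flip []             = ≈-refl
  Σvalue-flip ((u , v) ∷ P) = ≈-trans (+-cong (value-xx-swap u v) (Σvalue-flip P))
                                      (≈-reflexive (sym (ℤ.neg-distrib-+ (value (xx u v)) (Σvalue (pairs P)))))

  termsᴸ-flip : ∀ P → termsᴸ (pairs (flip P)) ↭ termsᴸ (pairs P)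
  termsᴸ-flip []             = refl
  termsᴸ-flip ((u , v) ∷ P) = swap (xyPow {n} v) (xyPow {n} u) (termsᴸ-flip P)

  termsᴸ-++ : ∀ A B → termsᴸ (A ++ B) ≡ termsᴸ A ++ termsᴸ B
  termsᴸ-++ = List.concatMap-++ terms

  termsᴸ-mono : ∀ {A B : List Item} → A ⊆ B → termsᴸ A ⊆ termsᴸ B
  termsᴸ-mono []         = []
  termsᴸ-mono (i ∷ʳ τ)   = Sublist.++⁺ˡ (terms i) (termsᴸ-mono τ)
  termsᴸ-mono (refl ∷ τ) = Sublist.++⁺ ⊆-refl (termsᴸ-mono τ)

  Σvalue-++ : ∀ A B → Σvalue (A ++ B) ≡ Σvalue A ⊕ Σvalue B
  Σvalue-++ []      B = sym (ℤ.+-identityˡ (Σvalue B))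
  Σvalue-++ (i ∷ A) B = trans (cong (value i ⊕_) (Σvalue-++ A B)) (sym (ℤ.+-assoc (value i) (Σvalue A) (Σvalue B)))

  sums : ℤ → List Item → List ℤ
  sums t []       = t ∷ []
  sums t (i ∷ is) = t ∷ sums (t ⊕ value i) is

  length-sums : ∀ t is → length (sums t is) ≡ suc (length is)
  length-sums t []       = refl
  length-sums t (i ∷ is) = cong suc (length-sums (t ⊕ value i) is)

  ∈-sums : ∀ {x} t is → x ∈ sums t is → ∃₂ λ A B → is ≡ A ++ B × x ≡ t ⊕ Σvalue A
  ∈-sums t []       (here refl) = [] , [] , refl , sym (ℤ.+-identityʳ t)
  ∈-sums t (i ∷ is) (here refl) = [] , i ∷ is , refl , sym (ℤ.+-identityʳ t)
  ∈-sums t (i ∷ is) (there x∈) with ∈-sums (t ⊕ value i) is x∈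
  ... | A , B , refl , refl = i ∷ A , B , refl , ℤ.+-assoc t (value i) (Σvalue A)

  sums-swap : ∀ t A i j B → ∃₂ λ P R → ∃₂ λ x x′ →
              sums t (A ++ i ∷ j ∷ B) ≡ P ++ x ∷ R × sums t (A ++ j ∷ i ∷ B) ≡ P ++ x′ ∷ R ×
              x′ ⊖ x ≡ value j ⊖ value i
  sums-swap t [] i j B =
    t ∷ [] , sums (t ⊕ value i ⊕ value j) B , t ⊕ value i , t ⊕ value j ,
    refl , cong (λ s → t ∷ t ⊕ value j ∷ sums s B) (lemma₁ t (value i) (value j)) , lemma₂ t (value i) (value j)
    where
    lemma₁ : ∀ t a b → t ⊕ b ⊕ a ≡ t ⊕ a ⊕ b
    lemma₁ = solve-∀
    lemma₂ : ∀ t a b → (t ⊕ b) ⊖ (t ⊕ a) ≡ b ⊖ a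
    lemma₂ = solve-∀
  sums-swap t (a ∷ A) i j B with sums-swap (t ⊕ value a) A i j B
  ... | P , R , x , x′ , e , e′ , d = t ∷ P , R , x , x′ , cong (t ∷_) e , cong (t ∷_) e′ , d

  module Free {S : List (Q n)} (free : ProductOneFree {n} S) where

    run≄identity : ∀ L → L ≢ [] → L ⊑ S → ¬ run L ≃ (false , 0ℤ)
    run≄identity []       L≢[] _              _ = L≢[] refl
    run≄identity (g ∷ gs) _    (T , τ , perm) r = free (T , τ , g , gs , perm , run⇒isOne g gs r)

    Σvalue≉0 : ∀ i B → termsᴸ (i ∷ B) ⊑ S → Σvalue (i ∷ B) ≉ 0ℤ
    Σvalue≉0 i B sub Σ≈0 = run≄identity (termsᴸ (i ∷ B)) (nonempty i) sub
      (≃-trans (run-items false 0ℤ (i ∷ B)) (refl , ≈-trans (≈-reflexive (ℤ.+-identityˡ _)) Σ≈0))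
      where
      nonempty : ∀ i → termsᴸ (i ∷ B) ≢ []
      nonempty (y _)    ()
      nonempty (xx _ _) ()

    sums-incongruent : ∀ t is → termsᴸ is ⊑ S → AllPairs _≉_ (sums t is)
    sums-incongruent t []       _   = [] ∷ []
    sums-incongruent t (i ∷ is) sub =
      All.tabulate later ∷
      sums-incongruent (t ⊕ value i) is (⊑-trans (⊆⇒⊑ (Sublist.++⁺ˡ (terms i) ⊆-refl)) sub)
      where
      later : ∀ {x} → x ∈ sums (t ⊕ value i) is → t ≉ x
      later x∈ t≈x with ∈-sums (t ⊕ value i) is x∈
      ... | A , B , refl , refl = Σvalue≉0 i A
        (⊑-trans (⊆⇒⊑ (termsᴸ-mono {i ∷ A} {i ∷ A ++ B} (refl ∷ Sublist.++⁺ʳ B ⊆-refl))) sub)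
        (begin
          value i ⊕ Σvalue A           ≡⟨ lemma t (value i) (Σvalue A) ⟩
          (t ⊕ value i ⊕ Σvalue A) ⊖ t  ≈⟨ +-cong (≈-sym t≈x) (≈-refl {⊝ t}) ⟩
          t ⊖ t                        ≡⟨ ℤ.+-inverseʳ t ⟩
          0ℤ                           ∎)
        where
        open ≈-Reasoning
        lemma : ∀ t v a → v ⊕ a ≡ ((t ⊕ v) ⊕ a) ⊖ t
        lemma = solve-∀

    Apart : List Item → ℤ → ℤ → Set
    Apart ch t t′ = ∀ {x x′} → x ∈ sums t ch → x′ ∈ sums t′ ch → x ≉ x′

    sums-apart-by-block : ∀ ch t t′ d D A C B → ch ≡ (A ++ C) ++ B → t′ ⊖ t ≈ Σvalue (d ∷ D) →
                    termsᴸ (d ∷ D ++ ch) ⊑ S → t ⊕ Σvalue A ≉ t′ ⊕ Σvalue (A ++ C)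
    sums-apart-by-block ch t t′ d D A C B ch≡ t′-t sub same = Σvalue≉0 d (D ++ C)
      (⊑-trans (⊆⇒⊑ (termsᴸ-mono {d ∷ D ++ C} {d ∷ D ++ ch} (Sublist.++⁺ ⊆-refl C⊆ch))) sub)
      (begin
        Σvalue (d ∷ D ++ C)                               ≡⟨ Σvalue-++ (d ∷ D) C ⟩
        Σvalue (d ∷ D) ⊕ Σvalue C                         ≈⟨ +-cong t′-t (≈-refl {Σvalue C}) ⟨
        (t′ ⊖ t) ⊕ Σvalue C                               ≡⟨ lemma t t′ (Σvalue A) (Σvalue C) ⟩
        (t′ ⊕ (Σvalue A ⊕ Σvalue C)) ⊖ (t ⊕ Σvalue A)     ≡⟨ cong (λ s → (t′ ⊕ s) ⊖ (t ⊕ Σvalue A)) (Σvalue-++ A C) ⟨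
        (t′ ⊕ Σvalue (A ++ C)) ⊖ (t ⊕ Σvalue A)           ≈⟨ +-cong (≈-sym same) (≈-refl {⊝ (t ⊕ Σvalue A)}) ⟩
        (t ⊕ Σvalue A) ⊖ (t ⊕ Σvalue A)                   ≡⟨ ℤ.+-inverseʳ (t ⊕ Σvalue A) ⟩
        0ℤ                                                ∎)
      where
      open ≈-Reasoning
      C⊆ch : C ⊆ ch
      C⊆ch = subst (C ⊆_) (sym ch≡) (Sublist.++⁺ʳ B (Sublist.++⁺ˡ A ⊆-refl))
      lemma : ∀ t t′ a c → (t′ ⊖ t) ⊕ c ≡ (t′ ⊕ (a ⊕ c)) ⊖ (t ⊕ a)
      lemma = solve-∀

    -- Coinciding sums from t and t′ differ by a block C of ch, so Σ C ≈ ±(t′ - t); then the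
    -- pairs p ∷ P, flipped in the case of the minus sign, followed by C would have sum 0.
    apart : ∀ ch t t′ p P → t′ ⊖ t ≈ Σvalue (pairs (p ∷ P)) →
            termsᴸ (pairs (p ∷ P) ++ ch) ⊑ S → Apart ch t t′
    apart ch t t′ p@(u , v) P t′-t sub x∈ x′∈ with ∈-sums t ch x∈ | ∈-sums t′ ch x′∈
    ... | A , B , ch≡ , refl | A′ , B′ , ch≡′ , refl with ++-split A B A′ B′ (trans (sym ch≡) ch≡′)
    ... | inj₁ (C , refl) = sums-apart-by-block ch t t′ (xx u v) (pairs P) A C B′ ch≡′ t′-t sub
    ... | inj₂ (C , refl) = sums-apart-by-block ch t′ t (xx v u) (pairs (flip P)) A′ C B ch≡ t-t′ sub′ ∘ ≈-sym
      where
      t-t′ : t ⊖ t′ ≈ Σvalue (pairs (flip (p ∷ P)))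
      t-t′ = begin
        t ⊖ t′                         ≡⟨ lemma t t′ ⟩
        ⊝ (t′ ⊖ t)                     ≈⟨ neg-cong t′-t ⟩
        ⊝ Σvalue (pairs (p ∷ P))       ≈⟨ Σvalue-flip (p ∷ P) ⟨
        Σvalue (pairs (flip (p ∷ P)))  ∎
        where
        open ≈-Reasoning
        lemma : ∀ t t′ → t ⊖ t′ ≡ ⊝ (t′ ⊖ t)
        lemma = solve-∀
      sub′ : termsᴸ (pairs (flip (p ∷ P)) ++ ch) ⊑ S
      sub′ = ⊑-trans (↭⇒⊑ (subst₂ _↭_ (sym (termsᴸ-++ (pairs (flip (p ∷ P))) ch))
                                      (sym (termsᴸ-++ (pairs (p ∷ P)) ch))
                                      (Perm.++⁺ʳ (termsᴸ ch) (termsᴸ-flip (p ∷ P))))) sub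

    grid : List Item → List ℤ → List ℤ
    grid ch []       = []
    grid ch (t ∷ ts) = sums t ch ++ grid ch ts

    grid-incongruent : ∀ ch ts → termsᴸ ch ⊑ S → AllPairs (Apart ch) ts → AllPairs _≉_ (grid ch ts)
    grid-incongruent ch []       _   []               = []
    grid-incongruent ch (t ∷ ts) sub (apart-t ∷ aps) =
      AllPairs.++⁺ (sums-incongruent t ch sub) (grid-incongruent ch ts sub aps)
                   (All.tabulate λ x∈ → separated x∈ apart-t)
      where
      separated : ∀ {x ts} → x ∈ sums t ch → All (Apart ch t) ts → All (x ≉_) (grid ch ts)
      separated x∈ []       = []
      separated x∈ (a ∷ as) = All.++⁺ (All.tabulate (a x∈)) (separated x∈ as)

    length-grid : ∀ ch ts → length (grid ch ts) ≡ length ts * suc (length ch)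
    length-grid ch []       = refl
    length-grid ch (t ∷ ts) = trans (List.length-++ (sums t ch)) (cong₂ _+_ (length-sums t ch) (length-grid ch ts))

    grid-bound : ∀ ch ts → termsᴸ ch ⊑ S → AllPairs (Apart ch) ts → length ts * suc (length ch) ≤ N
    grid-bound ch ts sub aps = subst (_≤ N) (length-grid ch ts) (incongruent-bound (grid-incongruent ch ts sub aps))

-- Sequences in normal form, and the case n ≥ 3

module NormalForm (m : ℕ) where
  open LiftedProducts m public

  normal : List (Fin N) → List (Fin N) → List (Q n)
  normal ys xs = map (yPow {n}) ys ++ map (xyPow {n}) xs

  yExps xExps : List (Q n) → List (Fin N)
  yExps []                = []
  yExps ((false , k) ∷ S) = k ∷ yExps S
  yExps ((true  , _) ∷ S) = yExps S
  xExps []                = []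
  xExps ((false , _) ∷ S) = xExps S
  xExps ((true  , k) ∷ S) = k ∷ xExps S

  ↭-normal : ∀ S → S ↭ normal (yExps S) (xExps S)
  ↭-normal []                = refl
  ↭-normal ((false , k) ∷ S) = prep _ (↭-normal S)
  ↭-normal ((true  , k) ∷ S) =
    ↭-trans (prep _ (↭-normal S)) (↭-sym (Perm.shift (true , k) (map (yPow {n}) (yExps S)) _))

  length-exps : ∀ S → length (yExps S) + length (xExps S) ≡ length S
  length-exps []                = refl
  length-exps ((false , _) ∷ S) = cong suc (length-exps S)
  length-exps ((true  , _) ∷ S) = trans (ℕ.+-suc _ _) (cong suc (length-exps S))

  pairsOf : List (Fin N) → List (Fin N × Fin N)
  pairsOf (u ∷ v ∷ r) = (u , v) ∷ pairsOf r
  pairsOf _           = []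

  length-pairsOf : ∀ r → length r ≤ suc (2 * length (pairsOf r))
  length-pairsOf []          = z≤n
  length-pairsOf (_ ∷ [])    = s≤s z≤n
  length-pairsOf (_ ∷ _ ∷ r) =
    subst (suc (suc (length r)) ≤_) (cong suc (sym (ℕ.*-suc 2 (length (pairsOf r))))) (s≤s (s≤s (length-pairsOf r)))

  flatten : List (Fin N × Fin N) → List (Fin N)
  flatten []             = []
  flatten ((u , v) ∷ P) = u ∷ v ∷ flatten P

  termsᴸ-pairs : ∀ P → termsᴸ (pairs P) ≡ map (xyPow {n}) (flatten P)
  termsᴸ-pairs []            = refl
  termsᴸ-pairs ((u , v) ∷ P) = cong (λ L → xyPow {n} u ∷ xyPow {n} v ∷ L) (termsᴸ-pairs P)

  termsᴸ-ys : ∀ ys → termsᴸ (map y ys) ≡ map (yPow {n}) ys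
  termsᴸ-ys []       = refl
  termsᴸ-ys (g ∷ ys) = cong (yPow {n} g ∷_) (termsᴸ-ys ys)

  flatten-pairsOf : ∀ r → flatten (pairsOf r) ⊆ r
  flatten-pairsOf []          = []
  flatten-pairsOf (u ∷ [])    = u ∷ʳ []
  flatten-pairsOf (_ ∷ _ ∷ r) = refl ∷ refl ∷ flatten-pairsOf r

  chain : List (Fin N) → List (Fin N) → List Item
  chain ys r = map y ys ++ pairs (pairsOf r)

  length-chain : ∀ ys r → length (chain ys r) ≡ length ys + length (pairsOf r)
  length-chain ys r = trans (List.length-++ (map y ys)) (cong₂ _+_ (List.length-map y ys) (List.length-map _ (pairsOf r)))

  chain-sub : ∀ ys P r → termsᴸ (pairs P ++ chain ys r) ⊑ normal ys (flatten P ++ r)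
  chain-sub ys P r = subst (_⊑ normal ys (flatten P ++ r)) (sym terms≡)
    (⊑-trans (↭⇒⊑ (Perm.shifts (map (xyPow {n}) (flatten P)) (map (yPow {n}) ys)))
             (⊆⇒⊑ (subst (shifted ⊆_) (cong (map (yPow {n}) ys ++_) (sym (List.map-++ (xyPow {n}) (flatten P) r))) shifted⊆)))
    where
    rest⊆ : map (xyPow {n}) (flatten (pairsOf r)) ⊆ map (xyPow {n}) r
    rest⊆ = Sublist.map⁺ (xyPow {n}) (flatten-pairsOf r)
    shifted = map (yPow {n}) ys ++ map (xyPow {n}) (flatten P) ++ map (xyPow {n}) (flatten (pairsOf r))
    shifted⊆ : shifted ⊆ map (yPow {n}) ys ++ map (xyPow {n}) (flatten P) ++ map (xyPow {n}) r
    shifted⊆ = Sublist.++⁺ (⊆-refl {x = map (yPow {n}) ys}) (Sublist.++⁺ (⊆-refl {x = map (xyPow {n}) (flatten P)}) rest⊆)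
    terms≡ : termsᴸ (pairs P ++ chain ys r) ≡
             map (xyPow {n}) (flatten P) ++ map (yPow {n}) ys ++ map (xyPow {n}) (flatten (pairsOf r))
    terms≡ = begin
      termsᴸ (pairs P ++ chain ys r)                                  ≡⟨ termsᴸ-++ (pairs P) (chain ys r) ⟩
      termsᴸ (pairs P) ++ termsᴸ (chain ys r)                         ≡⟨ cong (termsᴸ (pairs P) ++_) (termsᴸ-++ (map y ys) _) ⟩
      termsᴸ (pairs P) ++ termsᴸ (map y ys) ++ termsᴸ (pairs (pairsOf r))
        ≡⟨ cong₂ _++_ (termsᴸ-pairs P) (cong₂ _++_ (termsᴸ-ys ys) (termsᴸ-pairs (pairsOf r))) ⟩
      map (xyPow {n}) (flatten P) ++ map (yPow {n}) ys ++ map (xyPow {n}) (flatten (pairsOf r)) ∎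
      where open ≡-Reasoning

  ys⊑normal : ∀ {zs ys} xs → zs ⊑ ys → termsᴸ (map y zs) ⊑ normal ys xs
  ys⊑normal {zs} {ys} xs (C , τ , p) =
    subst (_⊑ normal ys xs) (sym (termsᴸ-ys zs))
          (map (yPow {n}) C , Sublist.++⁺ʳ _ (Sublist.map⁺ _ τ) , Perm.map⁺ _ p)

  y-bound : ∀ ys xs → ProductOneFree {n} (normal ys xs) → suc (length ys) ≤ N
  y-bound ys xs free = subst (_≤ N) (trans (length-sums 0ℤ (map y ys)) (cong suc (List.length-map y ys)))
                                     (incongruent-bound (sums-incongruent 0ℤ (map y ys) (ys⊑normal xs (↭⇒⊑ refl))))
    where open Free free

  two-pair-bound : ∀ ys u v r → ProductOneFree {n} (normal ys (u ∷ v ∷ r)) → 2 * suc (length (chain ys r)) ≤ N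
  two-pair-bound ys u v r free = grid-bound ch (0ℤ ∷ value (xx u v) ∷ []) ch⊑ ((apart₀₁ ∷ []) ∷ [] ∷ [])
    where
    open Free free
    ch = chain ys r
    base : termsᴸ (xx u v ∷ ch) ⊑ normal ys (u ∷ v ∷ r)
    base = chain-sub ys ((u , v) ∷ []) r
    ch⊑ : termsᴸ ch ⊑ normal ys (u ∷ v ∷ r)
    ch⊑ = ⊑-trans (⊆⇒⊑ (_ ∷ʳ _ ∷ʳ ⊆-refl)) base
    apart₀₁ : Apart ch 0ℤ (value (xx u v))
    apart₀₁ = apart ch 0ℤ (value (xx u v)) (u , v) [] ≈-refl base

  four-pair-bound : ∀ ys u₁ v₁ u₂ v₂ r → ProductOneFree {n} (normal ys (u₁ ∷ v₁ ∷ u₂ ∷ v₂ ∷ r)) →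
                    4 * suc (length (chain ys r)) ≤ N
  four-pair-bound ys u₁ v₁ u₂ v₂ r free =
    grid-bound ch (0ℤ ∷ c₁ ∷ c₂ ∷ c₁ ⊕ c₂ ∷ []) ch⊑
      ((apart₀₁ ∷ apart₀₂ ∷ apart₀₃ ∷ []) ∷ (apart₁₂ ∷ apart₁₃ ∷ []) ∷ (apart₂₃ ∷ []) ∷ [] ∷ [])
    where
    open Free free
    S = normal ys (u₁ ∷ v₁ ∷ u₂ ∷ v₂ ∷ r)
    ch = chain ys r
    c₁ = value (xx u₁ v₁)
    c₂ = value (xx u₂ v₂)
    both : termsᴸ (xx u₁ v₁ ∷ xx u₂ v₂ ∷ ch) ⊑ S
    both = chain-sub ys ((u₁ , v₁) ∷ (u₂ , v₂) ∷ []) r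
    first : termsᴸ (xx u₁ v₁ ∷ ch) ⊑ S
    first = ⊑-trans (⊆⇒⊑ (refl ∷ refl ∷ _ ∷ʳ _ ∷ʳ ⊆-refl)) both
    second : termsᴸ (xx u₂ v₂ ∷ ch) ⊑ S
    second = ⊑-trans (⊆⇒⊑ (_ ∷ʳ _ ∷ʳ ⊆-refl)) both
    first⁻¹-second : termsᴸ (xx v₁ u₁ ∷ xx u₂ v₂ ∷ ch) ⊑ S
    first⁻¹-second = ⊑-trans (↭⇒⊑ (swap _ _ refl)) both
    ch⊑ : termsᴸ ch ⊑ S
    ch⊑ = ⊑-trans (⊆⇒⊑ (_ ∷ʳ _ ∷ʳ ⊆-refl)) second
    apart₀₁ : Apart ch 0ℤ c₁
    apart₀₁ = apart ch 0ℤ c₁ (u₁ , v₁) [] ≈-refl first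
    apart₀₂ : Apart ch 0ℤ c₂
    apart₀₂ = apart ch 0ℤ c₂ (u₂ , v₂) [] ≈-refl second
    apart₀₃ : Apart ch 0ℤ (c₁ ⊕ c₂)
    apart₀₃ = apart ch 0ℤ (c₁ ⊕ c₂) (u₁ , v₁) ((u₂ , v₂) ∷ []) (≈-reflexive (lemma₀₃ c₁ c₂)) both
      where
      lemma₀₃ : ∀ a b → (a ⊕ b) ⊖ 0ℤ ≡ a ⊕ (b ⊕ 0ℤ)
      lemma₀₃ = solve-∀
    apart₁₂ : Apart ch c₁ c₂
    apart₁₂ = apart ch c₁ c₂ (v₁ , u₁) ((u₂ , v₂) ∷ [])
      (≈-trans (≈-reflexive (lemma₁₂ c₁ c₂)) (+-cong (≈-sym (value-xx-swap u₁ v₁)) (≈-refl {c₂ ⊕ 0ℤ})))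
      first⁻¹-second
      where
      lemma₁₂ : ∀ a b → b ⊖ a ≡ ⊝ a ⊕ (b ⊕ 0ℤ)
      lemma₁₂ = solve-∀
    apart₁₃ : Apart ch c₁ (c₁ ⊕ c₂)
    apart₁₃ = apart ch c₁ (c₁ ⊕ c₂) (u₂ , v₂) [] (≈-reflexive (lemma₁₃ c₁ c₂)) second
      where
      lemma₁₃ : ∀ a b → (a ⊕ b) ⊖ a ≡ b ⊕ 0ℤ
      lemma₁₃ = solve-∀
    apart₂₃ : Apart ch c₂ (c₁ ⊕ c₂)
    apart₂₃ = apart ch c₂ (c₁ ⊕ c₂) (u₁ , v₁) [] (≈-reflexive (lemma₂₃ c₁ c₂)) first
      where
      lemma₂₃ : ∀ a b → (a ⊕ b) ⊖ b ≡ a ⊕ 0ℤ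
      lemma₂₃ = solve-∀

  -- Swapping g and h changes only one of the partial sums of the y-terms; as both lists of
  -- sums consist of N incongruent integers, the changed sum is congruent to the old one.
  adjacent-equal : ∀ A g h B s → ProductOneFree {n} (normal (A ++ g ∷ h ∷ B) (s ∷ [])) →
                   suc (length (A ++ g ∷ h ∷ B)) ≡ N → g ≡ h
  adjacent-equal A g h B s free len with sums-swap 0ℤ (map y A) (y g) (y h) (map y B)
  ... | P , R , x , x′ , e , e′ , x′-x = sym (⟦⟧-injective (≈-resp-difference (sym x′-x) (≈-sym x≈x′)))
    where
    open Free free
    ys = A ++ g ∷ h ∷ B
    chain-of : ∀ i j → map y (A ++ i ∷ j ∷ B) ≡ map y A ++ y i ∷ y j ∷ map y B
    chain-of i j = List.map-++ y A (i ∷ j ∷ B)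
    incongruent : ∀ i j → A ++ i ∷ j ∷ B ↭ ys → AllPairs _≉_ (sums 0ℤ (map y A ++ y i ∷ y j ∷ map y B))
    incongruent i j p = subst (λ L → AllPairs _≉_ (sums 0ℤ L)) (chain-of i j)
                              (sums-incongruent 0ℤ _ (ys⊑normal (s ∷ []) (↭⇒⊑ p)))
    length-sums-ys : length (P ++ x ∷ R) ≡ N
    length-sums-ys = begin
      length (P ++ x ∷ R)                                      ≡⟨ cong length e ⟨
      length (sums 0ℤ (map y A ++ y g ∷ y h ∷ map y B))         ≡⟨ length-sums 0ℤ (map y A ++ y g ∷ y h ∷ map y B) ⟩
      suc (length (map y A ++ y g ∷ y h ∷ map y B))             ≡⟨ cong (suc ∘ length) (chain-of g h) ⟨
      suc (length (map y ys))                                  ≡⟨ cong suc (List.length-map y ys) ⟩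
      suc (length ys)                                          ≡⟨ len ⟩
      N                                                        ∎
      where open ≡-Reasoning
    x≈x′ : x ≈ x′
    x≈x′ = incongruent-replace P R (subst (AllPairs _≉_) e (incongruent g h refl))
                                (subst (AllPairs _≉_) e′ (incongruent h g (Perm.++⁺ˡ A (swap h g refl))))
                                length-sums-ys

  Σvalue-replicate : ∀ k g → Σvalue (replicate k (y g)) ≡ + (k * toℕ g)
  Σvalue-replicate zero    g = refl
  Σvalue-replicate (suc k) g = trans (cong (⟦ g ⟧ ⊕_) (Σvalue-replicate k g)) (sym (ℤ.pos-+ (toℕ g) (k * toℕ g)))

  1<N : 1 < N
  1<N = ℕ.*-monoʳ-≤ 2 (s≤s z≤n)

  one-x-structure : ∀ ys s → ProductOneFree {n} (normal ys (s ∷ [])) → suc (length ys) ≡ N →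
                    ∃ λ t → (1 ≤ toℕ t × gcd (toℕ t) N ≡ 1) × ys ≡ replicate (length ys) t
  one-x-structure []        s free len = ⊥-elim (ℕ.<⇒≢ 1<N len)
  one-x-structure (t ∷ ys′) s free len = t , coprime-if-no-annihilator (toℕ t) N 1<N no-annihilator , constant
    where
    open Free free
    ys = t ∷ ys′
    constant : ys ≡ replicate (length ys) t
    constant = adjacent-equal⇒replicate t ys′ λ P a b Q e →
      adjacent-equal P a b Q s (subst (λ zs → ProductOneFree {n} (normal zs (s ∷ []))) e free)
                               (subst (λ zs → suc (length zs) ≡ N) e len)
    no-annihilator : ∀ k → 0 < k → k < N → ¬ N ℕ∣.∣ k * toℕ t
    no-annihilator (suc k) _ k<N N∣kt = Σvalue≉0 (y t) (replicate k (y t)) sub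
      (≈-trans (≈-reflexive (Σvalue-replicate (suc k) t)) (Equivalence.from (≈0⇔∣ _) N∣kt))
      where
      k<ys : suc k ≤ length ys
      k<ys = ℕ.≤-pred (subst (suc k <_) (sym len) k<N)
      sub : termsᴸ (replicate (suc k) (y t)) ⊑ normal ys (s ∷ [])
      sub = subst (λ L → termsᴸ L ⊑ normal ys (s ∷ [])) (List.map-replicate y (suc k) t)
                  (ys⊑normal (s ∷ []) (⊆⇒⊑ (subst (replicate (suc k) t ⊆_) (sym constant) (replicate-⊆ t k<ys))))

  open Characters n

  termsᴸ-replicate : ∀ k g → termsᴸ (replicate k (y g)) ≡ replicate k (yPow {n} g)
  termsᴸ-replicate zero    g = refl
  termsᴸ-replicate (suc k) g = cong (yPow {n} g ∷_) (termsᴸ-replicate k g)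

  xBits-replicate : ∀ k g → χ-sum xBit (replicate k (yPow {n} g)) ≡ false
  xBits-replicate zero    g = refl
  xBits-replicate (suc k) g = xBits-replicate k g

  x∷replicate-free : ∀ s t L → L < N → gcd (toℕ t) N ≡ 1 →
                    ProductOneFree {n} (xyPow {n} s ∷ replicate L (yPow {n} t))
  x∷replicate-free s t L L<N coprime (_ ∷ T′ , refl ∷ τ , g , gs , perm , one) =
    contradiction (trans (cong (true xor_) (sym T′-even)) (product-one-χ-sum xBit xBit-character xBit-one g gs perm one))
                  λ ()
    where
    T′-even : χ-sum xBit T′ ≡ false
    T′-even = trans (cong (χ-sum xBit) (all≡⇒replicate _ (Sublist.All-resp-⊆ τ (All.replicate⁺ L refl))))
                    (xBits-replicate (length T′) t)
  x∷replicate-free s t L L<N coprime (T , _ ∷ʳ τ , g , gs , perm , one) =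
    ℕ.<⇒≱ (ℕ.≤-<-trans K≤L L<N) (ℕ∣.∣⇒≤ N∣K)
    where
    K = length (g ∷ gs)
    K≤L : K ≤ L
    K≤L = subst (_≤ L) (sym (Perm.↭-length perm))
                (ℕ.≤-trans (Sublist.length-mono-≤ τ) (ℕ.≤-reflexive (List.length-replicate L)))
    gs≡ : g ∷ gs ≡ termsᴸ (replicate K (y t))
    gs≡ = trans (all≡⇒replicate _ (Perm.All-resp-↭ (↭-sym perm) (Sublist.All-resp-⊆ τ (All.replicate⁺ L refl))))
                (sym (termsᴸ-replicate K t))
    Kt≈0 : + (K * toℕ t) ≈ 0ℤ
    Kt≈0 = ≈-trans (≈-reflexive (trans (sym (Σvalue-replicate K t)) (sym (ℤ.+-identityˡ _))))
             (proj₂ (≃-trans (≃-sym (run-items false 0ℤ (replicate K (y t))))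
                             (subst (λ L → foldl _▸_ (false , 0ℤ) L ≃ (false , 0ℤ)) gs≡ (isOne⇒run g gs one))))
    N∣K : N ℕ∣.∣ K
    N∣K = coprime-divisor (Coprime.sym (gcd≡1⇒coprime {toℕ t} {N} coprime))
                          (subst (N ℕ∣.∣_) (ℕ.*-comm K (toℕ t)) (Equivalence.to (≈0⇔∣ _) Kt≈0))

  UnitShape : List (Q n) → Set
  UnitShape S = Σ (Fin N) λ t → Σ (Fin N) λ s → (1 ≤ toℕ t) × (gcd (toℕ t) N ≡ 1) ×
                (S ↭ (xyPow {n} s ∷ replicate (N ∸ 1) (yPow {n} t)))

  unit-shape⇒free : ∀ S → UnitShape S → ProductOneFree {n} S
  unit-shape⇒free S (t , s , _ , coprime , S↭) =
    free-resp-↭ (↭-sym S↭) (x∷replicate-free s t (N ∸ 1) (ℕ.n<1+n (N ∸ 1)) coprime)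

  no-x-impossible : ∀ ys → ProductOneFree {n} (normal ys []) → length ys + 0 ≡ N → ⊥
  no-x-impossible ys free len =
    ℕ.<⇒≱ (y-bound ys [] free) (ℕ.≤-reflexive (trans (sym len) (ℕ.+-identityʳ (length ys))))

  one-x-unit-shape : ∀ ys s → ProductOneFree {n} (normal ys (s ∷ [])) → length ys + 1 ≡ N →
                     UnitShape (normal ys (s ∷ []))
  one-x-unit-shape ys s free len with one-x-structure ys s free (trans (ℕ.+-comm 1 (length ys)) len)
  ... | t , (1≤t , coprime) , ys≡ = t , s , 1≤t , coprime , ↭-trans (↭-sym (Perm.∷↭∷ʳ _ _)) (prep _ ys↭)
    where
    ys↭ : map (yPow {n}) ys ↭ replicate (N ∸ 1) (yPow {n} t)
    ys↭ = ↭-reflexive (begin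
      map (yPow {n}) ys                        ≡⟨ cong (map (yPow {n})) ys≡ ⟩
      map (yPow {n}) (replicate (length ys) t) ≡⟨ List.map-replicate _ (length ys) t ⟩
      replicate (length ys) (yPow {n} t)       ≡⟨ cong (λ k → replicate k (yPow {n} t)) (ℕ.m+n∸n≡m (length ys) 1) ⟨
      replicate (length ys + 1 ∸ 1) (yPow {n} t) ≡⟨ cong (λ k → replicate (k ∸ 1) (yPow {n} t)) len ⟩
      replicate (N ∸ 1) (yPow {n} t)           ∎)
      where open ≡-Reasoning

  module _ (2≤m : 2 ≤ m) where

    N≰5 : ¬ N ≤ 5
    N≰5 N≤5 = ℕ.<⇒≱ (s≤s N≤5) (ℕ.*-monoʳ-≤ 2 (s≤s 2≤m))

    two-x-impossible : ∀ ys u v r → length r ≤ 1 → ProductOneFree {n} (normal ys (u ∷ v ∷ r)) →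
                       length ys + (2 + length r) ≡ N → ⊥
    two-x-impossible ys u v r r≤1 free len = N≰5 (ℕ.m≤n⇒m≤1+n (two-x-forces-N≤4 (length ys) (length r) N
      (subst (λ k → 2 * suc k ≤ N) (trans (length-chain ys r) (no-pairs r r≤1)) (two-pair-bound ys u v r free))
      len r≤1))
      where
      no-pairs : ∀ r → length r ≤ 1 → length ys + length (pairsOf r) ≡ length ys
      no-pairs []          _ = ℕ.+-identityʳ (length ys)
      no-pairs (_ ∷ [])    _ = ℕ.+-identityʳ (length ys)
      no-pairs (_ ∷ _ ∷ _) (s≤s ())

    four-x-impossible : ∀ ys u₁ v₁ u₂ v₂ r → ProductOneFree {n} (normal ys (u₁ ∷ v₁ ∷ u₂ ∷ v₂ ∷ r)) →
                        length ys + (4 + length r) ≡ N → ⊥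
    four-x-impossible ys u₁ v₁ u₂ v₂ r free len = N≰5 (four-x-forces-N≤5 (length ys) (length (pairsOf r)) (length r) N
      (subst (λ k → 4 * suc k ≤ N) (length-chain ys r) (four-pair-bound ys u₁ v₁ u₂ v₂ r free))
      len (length-pairsOf r))

    free⇒unit-shape : ∀ S → length S ≡ N → ProductOneFree {n} S → UnitShape S
    free⇒unit-shape S len free =
      from-normal (yExps S) (xExps S) (free-resp-↭ (↭-normal S) free) (trans (length-exps S) len) (↭-normal S)
      where
      from-normal : ∀ ys xs → ProductOneFree {n} (normal ys xs) → length ys + length xs ≡ N →
                    S ↭ normal ys xs → UnitShape S
      from-normal ys []                       free len _  = ⊥-elim (no-x-impossible ys free len)
      from-normal ys (s ∷ [])                 free len S↭ with one-x-unit-shape ys s free len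
      ... | t , s′ , 1≤t , coprime , ↭shape = t , s′ , 1≤t , coprime , ↭-trans S↭ ↭shape
      from-normal ys (u ∷ v ∷ [])             free len _  = ⊥-elim (two-x-impossible ys u v [] z≤n free len)
      from-normal ys (u ∷ v ∷ w ∷ [])         free len _  = ⊥-elim (two-x-impossible ys u v (w ∷ []) (s≤s z≤n) free len)
      from-normal ys (u₁ ∷ v₁ ∷ u₂ ∷ v₂ ∷ r) free len _  = ⊥-elim (four-x-impossible ys u₁ v₁ u₂ v₂ r free len)

    free⇔unit-shape : ∀ S → length S ≡ N → ProductOneFree {n} S ⇔ UnitShape S
    free⇔unit-shape S len = mk⇔ (free⇒unit-shape S len) (unit-shape⇒free S)

-- The case n = 2, by exhaustive search

module Quaternion where
  open Characters 2

  _≟_ : DecidableEquality (Q 2)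
  _≟_ = ≡-dec Bool._≟_ Fin._≟_

  ∀? : {P : Q 2 → Set} → (∀ q → Dec (P q)) → Dec (∀ q → P q)
  ∀? P? = Dec.map′ (λ (f , t) → λ { (false , k) → f k ; (true , k) → t k })
                   (λ h → (λ k → h (false , k)) , (λ k → h (true , k)))
                   (Fin.all? (P? ∘ (false ,_)) ×-dec Fin.all? (P? ∘ (true ,_)))

  oddExp : Q 2 → Bool
  oddExp (_ , k) = toℕ k ℕ.% 2 ℕ.≡ᵇ 1

  -- a character only because n = 2 is even: x y^b x y^d = y^(2 + d - b)
  oddExp-character : IsCharacter oddExp
  oddExp-character = Dec.toWitness {a? = ∀? λ a → ∀? λ b → oddExp (mul {2} a b) Bool.≟ (oddExp a xor oddExp b)} _

  oddExp-one : ∀ q → IsOne {2} q → oddExp q ≡ false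
  oddExp-one (_ , k) (_ , k≡0) = cong (λ i → i ℕ.% 2 ℕ.≡ᵇ 1) k≡0

  data Unproductive (T : List (Q 2)) : Set where
    odd-xBits : χ-sum xBit T ≡ true → Unproductive T
    odd-exps  : χ-sum oddExp T ≡ true → Unproductive T
    empty     : T ≡ [] → Unproductive T
    square    : ∀ a → T ≡ a ∷ a ∷ [] → ¬ IsOne {2} (mul {2} a a) → Unproductive T

  unproductive : ∀ {T} → Unproductive T → ∀ g gs → g ∷ gs ↭ T → ¬ IsOne {2} (prod {2} g gs)
  unproductive (odd-xBits odd) g gs perm one =
    contradiction (trans (sym odd) (product-one-χ-sum xBit xBit-character xBit-one g gs perm one)) λ ()
  unproductive (odd-exps odd) g gs perm one =
    contradiction (trans (sym odd) (product-one-χ-sum oddExp oddExp-character oddExp-one g gs perm one)) λ ()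
  unproductive (empty refl) g gs perm one = Perm.¬x∷xs↭[] perm
  unproductive (square a refl a²≢1) g gs perm one
    with trans (all≡⇒replicate a (Perm.All-resp-↭ (↭-sym perm) (refl ∷ refl ∷ [])))
               (cong (λ k → replicate k a) (Perm.↭-length perm))
  ... | refl = a²≢1 one

  unproductive? : (T : List (Q 2)) → Maybe (Unproductive T)
  unproductive? T with χ-sum xBit T Bool.≟ true | χ-sum oddExp T Bool.≟ true
  ... | yes odd | _       = just (odd-xBits odd)
  ... | no _    | yes odd = just (odd-exps odd)
  ... | no _    | no _    = short T
    where
    short : ∀ T → Maybe (Unproductive T)
    short []           = just (empty refl)
    short (a ∷ b ∷ []) with a ≟ b | isOne? {2} (mul {2} a a)
    ... | yes refl | no a²≢1 = just (square a refl a²≢1)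
    ... | _        | _       = nothing
    short _            = nothing

  free? : (L : List (Q 2)) → Maybe (ProductOneFree {2} L)
  free? L = Maybe.map (λ all (T , τ , g , gs , perm , one) → unproductive (AllSublists-⊆ all τ) g gs perm one)
                      (allSublists? unproductive? L)

  product-ones : (S : List (Q 2)) → List (ProductOneSubseq {2} S)
  product-ones S = concatMap (λ (T , τ) → mapMaybe (witness T τ) (orderings T)) (sublists S)
    where
    witness : ∀ T → T ⊆ S → ∃ (_↭ T) → Maybe (ProductOneSubseq {2} S)
    witness T τ ([]     , _)    = nothing
    witness T τ (g ∷ gs , perm) =
      Maybe.map (λ one → T , τ , g , gs , perm , one) (dec⇒maybe (isOne? {2} (prod {2} g gs)))

  F₁ F₂ F₃ : Fin 4 → Fin 4 → List (Q 2)
  F₁ r s = yPow {2} r ∷ yPow {2} r ∷ yPow {2} r ∷ xyPow {2} s ∷ []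
  F₂ r s = yPow {2} r ∷ xyPow {2} s ∷ xyPow {2} s ∷ xyPow {2} s ∷ []
  F₃ r s = xyPow {2} s ∷ xyPow {2} s ∷ xyPow {2} s ∷ xyPow {2} (addZ {2} r s) ∷ []

  Odd : Fin 4 → Set
  Odd r = (toℕ r ≡ 1) ⊎ (toℕ r ≡ 3)

  Shape : List (Q 2) → Set
  Shape S = Σ (Fin 4) λ r → Σ (Fin 4) λ s → Odd r × ((S ↭ F₁ r s) ⊎ (S ↭ F₂ r s) ⊎ (S ↭ F₃ r s))

  shapes : (S : List (Q 2)) → List (Shape S)
  shapes S = concatMap (λ (r , odd) → concatMap (candidates r odd) (allFin 4))
                      ((# 1 , inj₁ refl) ∷ (# 3 , inj₂ refl) ∷ [])
    where
    candidates : ∀ r → Odd r → Fin 4 → List (Shape S)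
    candidates r odd s = map (λ which → r , s , odd , which) (catMaybes
      (Maybe.map inj₁ (permutation? _≟_ S (F₁ r s)) ∷
       Maybe.map (inj₂ ∘ inj₁) (permutation? _≟_ S (F₂ r s)) ∷
       Maybe.map (inj₂ ∘ inj₂) (permutation? _≟_ S (F₃ r s)) ∷ []))

  exhaustive : ∀ a b c d → let S = a ∷ b ∷ c ∷ d ∷ [] in T (is-just (head (product-ones S)) ∨ is-just (head (shapes S)))
  exhaustive = Dec.toWitness {a? = ∀? λ a → ∀? λ b → ∀? λ c → ∀? λ d → let S = a ∷ b ∷ c ∷ d ∷ [] in
                                 T? (is-just (head (product-ones S)) ∨ is-just (head (shapes S)))} _

  free⇒shape : ∀ S → length S ≡ 4 → ProductOneFree {2} S → Shape S
  free⇒shape (a ∷ b ∷ c ∷ d ∷ []) _ free = decide (head (product-ones S)) (head (shapes S)) (exhaustive a b c d)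
    where
    S = a ∷ b ∷ c ∷ d ∷ []
    decide : (w : Maybe (ProductOneSubseq {2} S)) (sh : Maybe (Shape S)) → T (is-just w ∨ is-just sh) → Shape S
    decide (just w) _         _ = ⊥-elim (free w)
    decide nothing  (just sh) _ = sh

  families? : ∀ r s →
              Maybe (ProductOneFree {2} (F₁ r s) × ProductOneFree {2} (F₂ r s) × ProductOneFree {2} (F₃ r s))
  families? r s = Maybe.zip (free? (F₁ r s)) (Maybe.zip (free? (F₂ r s)) (free? (F₃ r s)))

  families-certified : ∀ r s → Odd r → T (is-just (families? r s))
  families-certified = Dec.toWitness {a? = Fin.all? λ r → Fin.all? λ s →
                         (toℕ r ℕ.≟ 1 ⊎-dec toℕ r ℕ.≟ 3) →-dec T? (is-just (families? r s))} _

  shape⇒free : ∀ S → Shape S → ProductOneFree {2} S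
  shape⇒free S (r , s , odd , which) with Maybe.to-witness-T (families? r s) (families-certified r s odd) | which
  ... | free₁ , _     , _     | inj₁ S↭        = free-resp-↭ (↭-sym S↭) free₁
  ... | _     , free₂ , _     | inj₂ (inj₁ S↭) = free-resp-↭ (↭-sym S↭) free₂
  ... | _     , _     , free₃ | inj₂ (inj₂ S↭) = free-resp-↭ (↭-sym S↭) free₃

  free⇔shape : ∀ S → length S ≡ 4 → ProductOneFree {2} S ⇔ Shape S
  free⇔shape S len = mk⇔ (free⇒shape S len) (shape⇒free S)

theorem1p4 :
    ((n : ℕ) → 3 ≤ n → (S : List (Q n)) → length S ≡ 2 * n →
      (ProductOneFree {n} S ⇔
        (Σ (Fin (2 * n)) λ t → Σ (Fin (2 * n)) λ s →
          (1 ≤ toℕ t) × (gcd (toℕ t) (2 * n) ≡ 1) ×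
          (S ↭ (xyPow {n} s ∷ replicate (2 * n ∸ 1) (yPow {n} t))))))
    ×
    ((S : List (Q 2)) → length S ≡ 4 →
      (ProductOneFree {2} S ⇔
        (Σ (Fin 4) λ r → Σ (Fin 4) λ s →
          ((toℕ r ≡ 1) ⊎ (toℕ r ≡ 3)) ×
          ((S ↭ (yPow {2} r ∷ yPow {2} r ∷ yPow {2} r ∷ xyPow {2} s ∷ []))
           ⊎ (S ↭ (yPow {2} r ∷ xyPow {2} s ∷ xyPow {2} s ∷ xyPow {2} s ∷ []))
           ⊎ (S ↭ (xyPow {2} s ∷ xyPow {2} s ∷ xyPow {2} s ∷ xyPow {2} (addZ {2} r s) ∷ []))))))
theorem1p4 = (λ { (suc m) (s≤s 2≤m) → NormalForm.free⇔unit-shape m 2≤m }) , Quaternion.free⇔shape
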